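{- Let $Q$ be the cube graph (the $1$-skeleton of the $3$-dimensional cube, with $8$ vertices and $12$ edges). Then $\eta(Q)\le 2/3$.
   Context: For a graph $G=(V,E)$ admitting a perfect matching, a weight function is a map $w:E\to\mathbb{R}_{\ge 0}$ that is not identically zero. For $E'\subseteq E$ let $w(E')=\sum_{e\in E'}w(e)$. Let $M^*(G)$ be a maximum weight matching and $P^*(G)$ a maximum weight perfect matching of $G$. Define $\eta(G)=\min_{w} \frac{w(P^*(G))}{w(M^*(G))}$. -}

module Defs where

open import Data.Nat using (ℕ; _+_; _≤_)
open import Data.Fin using (Fin; zero; suc; #_)
open import Data.Bool using (Bool; true; false; if_then_else_)
open import Data.Product using (_×_; _,_; proj₁; proj₂; ∃)
open import Data.Sum using (_⊎_)
open import Data.List using (List; map)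
open import Data.Nat.ListAction using (sum)
open import Data.List using () renaming (allFin to allFinL)
open import Relation.Binary.PropositionalEquality using (_≡_)

record Graph : Set where
  field
    nV    : ℕ
    nE    : ℕ
    ends  : Fin nE → Fin nV × Fin nV

open Graph public

Vertex : Graph → Set
Vertex G = Fin (nV G)

Edge : Graph → Set
Edge G = Fin (nE G)

EdgeSet : Graph → Set
EdgeSet G = Edge G → Bool

Incident : (G : Graph) → Edge G → Vertex G → Set
Incident G e v = v ≡ proj₁ (ends G e) ⊎ v ≡ proj₂ (ends G e)

IsMatching : (G : Graph) → EdgeSet G → Set
IsMatching G M = ∀ e f v → M e ≡ true → M f ≡ true →
                 Incident G e v → Incident G f v → e ≡ f

IsPerfectMatching : (G : Graph) → EdgeSet G → Set
IsPerfectMatching G M =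
  IsMatching G M × (∀ v → ∃ λ e → M e ≡ true × Incident G e v)

Weight : Graph → Set
Weight G = Edge G → ℕ

weightOf : (G : Graph) → Weight G → EdgeSet G → ℕ
weightOf G w S = sum (map (λ e → if S e then w e else 0) (allFinL (nE G)))

IsMaxWeightMatching : (G : Graph) → Weight G → EdgeSet G → Set
IsMaxWeightMatching G w M =
  IsMatching G M × (∀ N → IsMatching G N → weightOf G w N ≤ weightOf G w M)

IsMaxWeightPerfectMatching : (G : Graph) → Weight G → EdgeSet G → Set
IsMaxWeightPerfectMatching G w P =
  IsPerfectMatching G P ×
  (∀ N → IsPerfectMatching G N → weightOf G w N ≤ weightOf G w P)

-- The cube graph Q: vertex i ∈ {0..7} is the 0/1-vector given by the
-- binary digits of i; edges join vertices differing in exactly one bit.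
cubeEnds : Fin 12 → Fin 8 × Fin 8
cubeEnds zero = # 0 , # 1
cubeEnds (suc zero) = # 2 , # 3
cubeEnds (suc (suc zero)) = # 4 , # 5
cubeEnds (suc (suc (suc zero))) = # 6 , # 7
cubeEnds (suc (suc (suc (suc zero)))) = # 0 , # 2
cubeEnds (suc (suc (suc (suc (suc zero))))) = # 1 , # 3
cubeEnds (suc (suc (suc (suc (suc (suc zero)))))) = # 4 , # 6
cubeEnds (suc (suc (suc (suc (suc (suc (suc zero))))))) = # 5 , # 7
cubeEnds (suc (suc (suc (suc (suc (suc (suc (suc zero)))))))) = # 0 , # 4
cubeEnds (suc (suc (suc (suc (suc (suc (suc (suc (suc zero))))))))) = # 1 , # 5
cubeEnds (suc (suc (suc (suc (suc (suc (suc (suc (suc (suc zero)))))))))) = # 2 , # 6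
cubeEnds (suc (suc (suc (suc (suc (suc (suc (suc (suc (suc (suc zero))))))))))) = # 3 , # 7

Q : Graph
Q = record { nV = 8 ; nE = 12 ; ends = cubeEnds }

module Submission where

-- Put weight 1 on the three edges {1,3}, {2,6}, {4,5} of the
-- cube and weight 0 elsewhere.  These edges form a matching of weight 3,
-- so every maximum weight matching weighs at least 3.  They cover the three
-- neighbours 1, 2, 4 of vertex 0, one neighbour each.  A perfect matching
-- must match 0 to some neighbour u, and then cannot contain the heavy edge
-- at u; so it weighs at most 2, giving  3·w(P*) ≤ 6 ≤ 2·w(M*).

open import Defs
open import Data.Nat using (_*_; _≤_; z≤n)
open import Data.Nat.Properties using (≤-refl; ≤-reflexive; ≤-trans; +-mono-≤; *-monoʳ-≤; module ≤-Reasoning)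
open import Data.Product using (_×_; ∃; _,_; proj₁; proj₂)
open import Data.Sum using (inj₁; inj₂; [_,_]′)
open import Data.Fin using (zero; suc; #_)
open import Data.Fin.Properties using (all?) renaming (_≟_ to _≟ᶠ_)
open import Data.Bool using (true; false; if_then_else_; not)
open import Data.Bool.Properties using () renaming (_≟_ to _≟ᵇ_)
open import Data.List using ([]; _∷_; map) renaming (allFin to allFinL)
open import Data.Nat.ListAction using (sum)
open import Relation.Nullary using (Dec; yes; no; does)
open import Relation.Nullary.Decidable using (_⊎-dec_; _→-dec_; from-yes)
open import Relation.Binary.PropositionalEquality using (_≢_; _≡_; refl; sym; trans; cong)

incident? : (G : Graph) → (e : Edge G) → (v : Vertex G) → Dec (Incident G e v)
incident? G e v = (v ≟ᶠ proj₁ (ends G e)) ⊎-dec (v ≟ᶠ proj₂ (ends G e))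

matching? : (G : Graph) → (M : EdgeSet G) → Dec (IsMatching G M)
matching? G M =
  all? λ e → all? λ f → all? λ v →
    (M e ≟ᵇ true) →-dec (M f ≟ᵇ true) →-dec
    incident? G e v →-dec incident? G f v →-dec (e ≟ᶠ f)

matching-excludes : (G : Graph) (M : EdgeSet G) → IsMatching G M →
  ∀ {e f v} → M e ≡ true → Incident G e v → Incident G f v → e ≢ f →
  M f ≡ false
matching-excludes G M isM {e} {f} {v} Me inc-e inc-f e≢f with M f in Mf
... | true  with () ← e≢f (isM e f v Me Mf inc-e inc-f)
... | false = refl

allBut : (G : Graph) → Edge G → EdgeSet G
allBut G x e = not (does (e ≟ᶠ x))

weightOf-mono : (G : Graph) (w : Weight G) (S T : EdgeSet G) →
  (∀ e → S e ≡ true → T e ≡ true) → weightOf G w S ≤ weightOf G w T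
weightOf-mono G w S T S⊆T = sum-mono (allFinL (nE G))
  where
  summand-mono : ∀ e → (if S e then w e else 0) ≤ (if T e then w e else 0)
  summand-mono e with S e in Se | T e in Te
  ... | false | _     = z≤n
  ... | true  | true  = ≤-refl
  ... | true  | false with () ← trans (sym (S⊆T e Se)) Te
  sum-mono : ∀ es → sum (map (λ e → if S e then w e else 0) es)
                  ≤ sum (map (λ e → if T e then w e else 0) es)
  sum-mono []       = z≤n
  sum-mono (e ∷ es) = +-mono-≤ (summand-mono e) (sum-mono es)

missing-edge-bound : (G : Graph) (w : Weight G) (S : EdgeSet G) (x : Edge G) →
  S x ≡ false → weightOf G w S ≤ weightOf G w (allBut G x)
missing-edge-bound G w S x Sx = weightOf-mono G w S (allBut G x) S⊆allBut
  where
  S⊆allBut : ∀ e → S e ≡ true → allBut G x e ≡ true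
  S⊆allBut e Se with e ≟ᶠ x
  ... | yes refl with () ← trans (sym Se) Sx
  ... | no _     = refl

pattern e01 = zero
pattern e23 = suc e01
pattern e45 = suc e23
pattern e67 = suc e45
pattern e02 = suc e67
pattern e13 = suc e02
pattern e46 = suc e13
pattern e57 = suc e46
pattern e04 = suc e57
pattern e15 = suc e04
pattern e26 = suc e15
pattern e37 = suc e26

-- The heavy edges: a matching covering the neighbours 1, 2, 4 of vertex 0.
data Heavy : Set where
  h13 h26 h45 : Heavy

heavyEdge : Heavy → Edge Q
heavyEdge h13 = e13
heavyEdge h26 = e26
heavyEdge h45 = e45

w₃ : Weight Q
w₃ e13 = 1
w₃ e26 = 1
w₃ e45 = 1
w₃ _   = 0

heavyMatching : EdgeSet Q
heavyMatching e13 = true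
heavyMatching e26 = true
heavyMatching e45 = true
heavyMatching _   = false

heavyMatching-isMatching : IsMatching Q heavyMatching
heavyMatching-isMatching = from-yes (matching? Q heavyMatching)

heavyMatching-weight : weightOf Q w₃ heavyMatching ≡ 3
heavyMatching-weight = refl

allBut-heavy-weight : ∀ h → weightOf Q w₃ (allBut Q (heavyEdge h)) ≡ 2
allBut-heavy-weight h13 = refl
allBut-heavy-weight h26 = refl
allBut-heavy-weight h45 = refl

at-vertex-0 : ∀ {A : Set} e → Incident Q e (# 0) →
  (e ≡ e01 → A) → (e ≡ e02 → A) → (e ≡ e04 → A) → A
at-vertex-0 e01 _ k01 _ _ = k01 refl
at-vertex-0 e02 _ _ k02 _ = k02 refl
at-vertex-0 e04 _ _ _ k04 = k04 refl
at-vertex-0 e23 inc = [ (λ ()) , (λ ()) ]′ inc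
at-vertex-0 e45 inc = [ (λ ()) , (λ ()) ]′ inc
at-vertex-0 e67 inc = [ (λ ()) , (λ ()) ]′ inc
at-vertex-0 e13 inc = [ (λ ()) , (λ ()) ]′ inc
at-vertex-0 e46 inc = [ (λ ()) , (λ ()) ]′ inc
at-vertex-0 e57 inc = [ (λ ()) , (λ ()) ]′ inc
at-vertex-0 e15 inc = [ (λ ()) , (λ ()) ]′ inc
at-vertex-0 e26 inc = [ (λ ()) , (λ ()) ]′ inc
at-vertex-0 e37 inc = [ (λ ()) , (λ ()) ]′ inc

-- A perfect matching matches 0 to a neighbour u ∈ {1, 2, 4}, which blocks
-- the heavy edge at u.
perfect-misses-heavy : ∀ P → IsPerfectMatching Q P →
  ∃ λ h → P (heavyEdge h) ≡ false
perfect-misses-heavy P (isM , covers) with covers (# 0)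
... | e , Pe , inc = at-vertex-0 e inc
  (λ { refl → h13 , matching-excludes Q P isM {v = # 1} Pe (inj₂ refl) (inj₁ refl) (λ ()) })
  (λ { refl → h26 , matching-excludes Q P isM {v = # 2} Pe (inj₂ refl) (inj₁ refl) (λ ()) })
  (λ { refl → h45 , matching-excludes Q P isM {v = # 4} Pe (inj₂ refl) (inj₁ refl) (λ ()) })

perfect-weight-≤2 : ∀ P → IsPerfectMatching Q P → weightOf Q w₃ P ≤ 2
perfect-weight-≤2 P isP with perfect-misses-heavy P isP
... | h , misses = ≤-trans (missing-edge-bound Q w₃ P (heavyEdge h) misses)
                           (≤-reflexive (allBut-heavy-weight h))

proposition3p3 : ∃ λ (w : Weight Q) → (∃ λ e → w e ≢ 0) ×
    (∀ P M → IsMaxWeightPerfectMatching Q w P → IsMaxWeightMatching Q w M →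
      3 * weightOf Q w P ≤ 2 * weightOf Q w M)
proposition3p3 = w₃ , (e13 , λ ()) , bound
  where
  open ≤-Reasoning
  bound : ∀ P M → IsMaxWeightPerfectMatching Q w₃ P → IsMaxWeightMatching Q w₃ M →
    3 * weightOf Q w₃ P ≤ 2 * weightOf Q w₃ M
  bound P M (P-perfect , _) (_ , M-maximum) = begin
    3 * weightOf Q w₃ P               ≤⟨ *-monoʳ-≤ 3 (perfect-weight-≤2 P P-perfect) ⟩
    2 * 3                             ≡⟨ cong (2 *_) heavyMatching-weight ⟨
    2 * weightOf Q w₃ heavyMatching   ≤⟨ *-monoʳ-≤ 2 (M-maximum heavyMatching heavyMatching-isMatching) ⟩
    2 * weightOf Q w₃ M               ∎
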